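{- Let $p$ be a prime, $r\geq 0$ an integer and $n\geq \sum_{k=1}^r p^k$ an integer. Then \[ B_{n-\sum_{k=1}^r p^k}\equiv B_{n,-r}\pmod p. \]
   Context: $B_n$ denotes the $n$-th Bell number. For every integer $r\in\mathbb{Z}$, the $r$-Bell numbers $B_{n,r}$ are defined by $\sum_{n\geq 0}B_{n,r}\frac{t^n}{n!}=e^{e^t-1+rt}$, so $B_{n,0}=B_n$. -}

module Defs where

open import Data.Nat as ℕ using (ℕ; zero; suc)
open import Data.Nat.Combinatorics using (_C_)
open import Data.Integer as ℤ using (ℤ; +_)
open import Data.List using (List; map; upTo)
open import Data.List using () renaming (foldr to lfoldr)

sumℤ : ℕ → (ℕ → ℤ) → ℤ
sumℤ zero  f = + 0
sumℤ (suc n) f = sumℤ n f ℤ.+ f n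

sumℕ : ℕ → (ℕ → ℕ) → ℕ
sumℕ zero  f = 0
sumℕ (suc n) f = sumℕ n f ℕ.+ f n

-- Bell numbers: B 0 = 1, B (n+1) = Σ_{k=0}^{n} C(n,k) B k
-- (the coefficient recurrence of the EGF e^{e^t - 1}, obtained by
-- differentiating: F' = e^t F).
open import Data.Vec using (Vec; []; _∷_; lookup)
open import Data.Fin using (Fin; fromℕ<)
import Data.Fin
import Relation.Nullary

-- bellVec n = (B n , B (n-1) , ... , B 0)
bellVec : (n : ℕ) → Vec ℕ (suc n)
bellVec zero = 1 ∷ []
bellVec (suc n) = next ∷ prev
  where
  prev : Vec ℕ (suc n)
  prev = bellVec n
  -- B k sits at position n - k in prev
  bk : ℕ → ℕ
  bk k with k ℕ.<? suc n
  ... | Relation.Nullary.yes k<  = lookup prev (Data.Fin.opposite (fromℕ< k<))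
  ... | Relation.Nullary.no  _   = 0
  next : ℕ
  next = sumℕ (suc n) (λ k → (n C k) ℕ.* bk k)
  
Bell : ℕ → ℕ
Bell n = Data.Vec.head (bellVec n)

-- r-Bell numbers for r ∈ ℤ, EGF e^{e^t - 1 + r t} = e^{r t} · e^{e^t - 1};
-- coefficient extraction of the product gives
--   B_{n,r} = Σ_{k=0}^{n} C(n,k) r^{n-k} B_k.
rBell : ℕ → ℤ → ℤ
rBell n r = sumℤ (suc n) (λ k → (+ (n C k)) ℤ.* (r ℤ.^ (n ℕ.∸ k)) ℤ.* (+ Bell k))

module Submission where

-- Umbrally, B_{n,a} = L((x+a)^n) for the linear functional L with L(x^n) = B_n. Polynomials in x
-- are realised as operators built from the shift E on integer sequences, and L evaluates such an
-- operator on the sequence of Bell numbers at 0; thus (x+a)^n is (E ⊕ a) ^[ n ]. The Bell recurrence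
-- says L(x f(x)) = L(f(x+1)). Modulo p, (x+a)^p ≡ x^p + a^p and a^p ≡ a. Touchard's congruence
-- B_{m+p} ≡ B_{m+1} + B_m follows from B_p ≡ 2 (the Stirling numbers S(p,k) vanish mod p for
-- 1 < k < p) and says that x^p acts as x + 1 under L, even after multiplying by any polynomial;
-- iterating Frobenius, x^(p^k) acts as x + k. Hence (x-k)^(p^k) acts as x, so
-- B_{M+p^k,-k} ≡ L(x (x-k)^M) = L((x-k+1)^M) = B_{M,-(k-1)}, and induction on r removes
-- p^r, ..., p one at a time.

open import Defs

module BellCongruences where
  open import Data.Nat as ℕ using (ℕ; zero; suc; _<_; z≤n; s≤s; _∸_; _!; _<?_)
  import Data.Nat.Properties as ℕ
  open import Data.Nat.Combinatorics using (_C_; k>n⇒nCk≡0; nCk+nC[k+1]≡[n+1]C[k+1]; nCk≡n!/k![n-k]!; k![n∸k]!∣n!; nCn≡1)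
  import Data.Nat.Divisibility as ℕ
  open import Data.Nat.GeneralisedArithmetic using (iterate)
  open import Data.Nat.Primality using (Prime; euclidsLemma; ¬prime[1]; prime⇒nonTrivial)
  open import Data.Integer as ℤ using (ℤ; +_; -_; _+_; _*_; _-_; _^_; -[1+_])
  import Data.Integer.Properties as ℤ
  open import Data.Integer.Divisibility.Signed using (_∣_; divides; ∣ᵤ⇒∣; ∣⇒∣ᵤ; ∣m⇒∣m*n)
  open import Data.Integer.Tactic.RingSolver using (solve-∀)
  open import Data.Fin as Fin using (Fin; zero; suc; toℕ; fromℕ<; opposite)
  import Data.Fin.Properties as Fin
  open import Data.Vec using (lookup)
  open import Data.List using (List; []; _∷_; map; _++_; replicate)
  open import Data.List.Properties using (map-∘; map-cong; map-id; map-replicate)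
  open import Data.Product using (Σ-syntax; _,_; proj₁; proj₂)
  open import Data.Sum using (inj₁; inj₂)
  open import Data.Unit using (⊤; tt)
  open import Data.Nat.Induction using (<-rec)
  open import Relation.Nullary using (¬_; yes; no; contradiction)
  open import Relation.Binary.Bundles using (Setoid)
  open import Relation.Binary.Structures using (IsEquivalence)
  open import Relation.Binary.PropositionalEquality

  sumℤ-cong : ∀ n {f g : ℕ → ℤ} → (∀ k → k < n → f k ≡ g k) → sumℤ n f ≡ sumℤ n g
  sumℤ-cong zero    f≡g = refl
  sumℤ-cong (suc n) f≡g = cong₂ _+_ (sumℤ-cong n (λ k k<n → f≡g k (ℕ.m<n⇒m<1+n k<n))) (f≡g n ℕ.≤-refl)

  sumℤ-+ : ∀ n (f g : ℕ → ℤ) → sumℤ n (λ k → f k + g k) ≡ sumℤ n f + sumℤ n g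
  sumℤ-+ zero    f g = refl
  sumℤ-+ (suc n) f g = trans (cong (_+ (f n + g n)) (sumℤ-+ n f g)) (interchange (sumℤ n f) (sumℤ n g) (f n) (g n))
    where
    interchange : ∀ a b c d → (a + b) + (c + d) ≡ (a + c) + (b + d)
    interchange = solve-∀

  sumℤ-*ˡ : ∀ n c (f : ℕ → ℤ) → sumℤ n (λ k → c * f k) ≡ c * sumℤ n f
  sumℤ-*ˡ zero    c f = sym (ℤ.*-zeroʳ c)
  sumℤ-*ˡ (suc n) c f = trans (cong (_+ c * f n) (sumℤ-*ˡ n c f)) (sym (ℤ.*-distribˡ-+ c (sumℤ n f) (f n)))

  sumℤ-suc-head : ∀ n (f : ℕ → ℤ) → sumℤ (suc n) f ≡ f 0 + sumℤ n (λ k → f (suc k))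
  sumℤ-suc-head zero    f = ℤ.+-comm (+ 0) (f 0)
  sumℤ-suc-head (suc n) f = trans (cong (_+ f (suc n)) (sumℤ-suc-head n f)) (ℤ.+-assoc (f 0) _ _)

  +-sumℕ : ∀ n (f : ℕ → ℕ) → + sumℕ n f ≡ sumℤ n (λ k → + f k)
  +-sumℕ zero    f = refl
  +-sumℕ (suc n) f = cong (_+ + f n) (+-sumℕ n f)

  -- Linear operators on integer sequences

  Seq : Set
  Seq = ℕ → ℤ

  Op : Set
  Op = Seq → Seq

  E : Op
  E f m = f (suc m)

  infixl 6 _⊕_ _⊞_ _⊟_
  infixl 7 _⊡_

  _⊞_ : Seq → Seq → Seq
  (f ⊞ g) m = f m + g m

  _⊡_ : ℤ → Seq → Seq
  (c ⊡ f) m = c * f m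

  _⊟_ : Seq → Seq → Seq
  (f ⊟ g) m = f m - g m

  _⊕_ : Op → ℤ → Op
  (T ⊕ a) f m = T f m + a * f m

  _^[_] : Op → ℕ → Op
  (T ^[ n ]) f = iterate T f n

  record IsLinear (T : Op) : Set where
    field
      ≗-cong : ∀ {f g} → f ≗ g → T f ≗ T g
      ⊞-homo : ∀ f g → T (f ⊞ g) ≗ T f ⊞ T g
      ⊡-homo : ∀ c f → T (c ⊡ f) ≗ c ⊡ T f
  open IsLinear public

  id-linear : IsLinear (λ f → f)
  id-linear = record { ≗-cong = λ f≗g → f≗g ; ⊞-homo = λ f g m → refl ; ⊡-homo = λ c f m → refl }

  ∘-linear : ∀ {S T} → IsLinear S → IsLinear T → IsLinear (λ f → S (T f))
  ∘-linear {S} {T} S-linear T-linear = record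
    { ≗-cong = λ f≗g → ≗-cong S-linear (≗-cong T-linear f≗g)
    ; ⊞-homo = λ f g m → trans (≗-cong S-linear (⊞-homo T-linear f g) m) (⊞-homo S-linear (T f) (T g) m)
    ; ⊡-homo = λ c f m → trans (≗-cong S-linear (⊡-homo T-linear c f) m) (⊡-homo S-linear c (T f) m)
    }

  E-linear : IsLinear E
  E-linear = record { ≗-cong = λ f≗g m → f≗g (suc m) ; ⊞-homo = λ f g m → refl ; ⊡-homo = λ c f m → refl }

  ⊕-linear : ∀ {T} → IsLinear T → ∀ a → IsLinear (T ⊕ a)
  ⊕-linear {T} T-linear a = record
    { ≗-cong = λ f≗g m → cong₂ _+_ (≗-cong T-linear f≗g m) (cong (a *_) (f≗g m))
    ; ⊞-homo = λ f g m → trans (cong₂ _+_ (⊞-homo T-linear f g m) (ℤ.*-distribˡ-+ a (f m) (g m)))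
                               (interchange (T f m) (T g m) (a * f m) (a * g m))
    ; ⊡-homo = λ c f m → trans (cong₂ _+_ (⊡-homo T-linear c f m) (*-swap a c (f m)))
                               (sym (ℤ.*-distribˡ-+ c (T f m) (a * f m)))
    }
    where
    interchange : ∀ x y z w → (x + y) + (z + w) ≡ (x + z) + (y + w)
    interchange = solve-∀
    *-swap : ∀ a c x → a * (c * x) ≡ c * (a * x)
    *-swap = solve-∀

  ⊟-homo : ∀ {T} → IsLinear T → ∀ f g → T (f ⊟ g) ≗ T f ⊟ T g
  ⊟-homo {T} T-linear f g m = begin
    T (f ⊟ g) m                 ≡⟨ ≗-cong T-linear (λ j → cong (λ z → f j + z) (sym (ℤ.-1*i≡-i (g j)))) m ⟩
    T (f ⊞ (- + 1) ⊡ g) m       ≡⟨ ⊞-homo T-linear f ((- + 1) ⊡ g) m ⟩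
    T f m + T ((- + 1) ⊡ g) m   ≡⟨ cong (λ z → T f m + z) (trans (⊡-homo T-linear (- + 1) g m) (ℤ.-1*i≡-i (T g m))) ⟩
    T f m - T g m               ∎
    where open ≡-Reasoning

  ^[]-linear : ∀ {T} → IsLinear T → ∀ n → IsLinear (T ^[ n ])
  ^[]-linear T-linear zero    = id-linear
  ^[]-linear T-linear (suc n) = ∘-linear (^[]-linear T-linear n) T-linear

  ^[]-+ : ∀ a b T f → (T ^[ a ℕ.+ b ]) f ≡ (T ^[ b ]) ((T ^[ a ]) f)
  ^[]-+ zero    b T f = refl
  ^[]-+ (suc a) b T f = ^[]-+ a b T (T f)

  ^[]-* : ∀ a b T f → (T ^[ a ℕ.* b ]) f ≡ ((T ^[ b ]) ^[ a ]) f
  ^[]-* zero    b T f = refl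
  ^[]-* (suc a) b T f = trans (^[]-+ b (a ℕ.* b) T f) (^[]-* a b T ((T ^[ b ]) f))

  E^[]-apply : ∀ k f m → (E ^[ k ]) f m ≡ f (k ℕ.+ m)
  E^[]-apply zero    f m = refl
  E^[]-apply (suc k) f m = E^[]-apply k (E f) m

  ^[]-cong-op : ∀ {U V} → IsLinear V → (∀ f → U f ≗ V f) → ∀ n f → (U ^[ n ]) f ≗ (V ^[ n ]) f
  ^[]-cong-op V-linear U≗V zero    f m = refl
  ^[]-cong-op {U} V-linear U≗V (suc n) f m =
    trans (^[]-cong-op V-linear U≗V n (U f) m) (≗-cong (^[]-linear V-linear n) (U≗V f) m)

  ^[]-suc : ∀ n T f → (T ^[ suc n ]) f ≡ T ((T ^[ n ]) f)
  ^[]-suc n T f = trans (cong (λ k → (T ^[ k ]) f) (ℕ.+-comm 1 n)) (^[]-+ n 1 T f)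

  ^[]-comm : ∀ {S T : Op} → (∀ f → T (S f) ≡ S (T f)) → ∀ n f → (T ^[ n ]) (S f) ≡ S ((T ^[ n ]) f)
  ^[]-comm         T∘S≡S∘T zero    f = refl
  ^[]-comm {S} {T} T∘S≡S∘T (suc n) f = trans (cong (T ^[ n ]) (T∘S≡S∘T f)) (^[]-comm {S} {T} T∘S≡S∘T n (T f))

  CommutesWithE : Op → Set
  CommutesWithE S = ∀ f → S (E f) ≡ E (S f)

  E^[]-commutesWithE : ∀ n → CommutesWithE (E ^[ n ])
  E^[]-commutesWithE n = ^[]-comm {E} {E} (λ f → refl) n

  E⊕^[]-commutesWithE : ∀ a n → CommutesWithE ((E ⊕ a) ^[ n ])
  E⊕^[]-commutesWithE a = ^[]-comm {E} {E ⊕ a} (λ f → refl)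

  binomialSum : ℕ → ℤ → (ℕ → ℤ) → ℤ
  binomialSum n a g = sumℤ (suc n) (λ k → + (n C k) * a ^ (n ∸ k) * g k)

  binomialSum-suc : ∀ n a g → binomialSum n a (λ k → g (suc k)) + a * binomialSum n a g ≡ binomialSum (suc n) a g
  binomialSum-suc n a g = sym (begin
    binomialSum (suc n) a g
      ≡⟨ sumℤ-suc-head (suc n) _ ⟩
    head + sumℤ (suc n) (λ k → + (suc n C suc k) * a ^ (n ∸ k) * g (suc k))
      ≡⟨ cong (λ z → head + z) (sumℤ-cong (suc n) (λ k _ → pascal k)) ⟩
    head + sumℤ (suc n) (λ k → X k + Y k)
      ≡⟨ cong (λ z → head + z) (sumℤ-+ (suc n) X Y) ⟩
    head + (sumℤ (suc n) X + sumℤ (suc n) Y)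
      ≡⟨ +-exchange head (sumℤ (suc n) X) (sumℤ (suc n) Y) ⟩
    sumℤ (suc n) X + (head + sumℤ (suc n) Y)
      ≡⟨ cong (λ z → sumℤ (suc n) X + z) (sym (sumℤ-suc-head (suc n) Z)) ⟩
    sumℤ (suc n) X + (sumℤ (suc n) Z + Z (suc n))
      ≡⟨ cong (λ z → sumℤ (suc n) X + (sumℤ (suc n) Z + z)) Z-last ⟩
    sumℤ (suc n) X + (sumℤ (suc n) Z + + 0)
      ≡⟨ cong (λ z → sumℤ (suc n) X + z) (ℤ.+-identityʳ _) ⟩
    sumℤ (suc n) X + sumℤ (suc n) Z
      ≡⟨ cong (λ z → sumℤ (suc n) X + z) (trans (sumℤ-cong (suc n) Z≡aW) (sumℤ-*ˡ (suc n) a W)) ⟩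
    sumℤ (suc n) X + a * sumℤ (suc n) W ∎)
    where
    open ≡-Reasoning
    head : ℤ
    head = + 1 * a ^ suc n * g 0
    X Y Z W : ℕ → ℤ
    X k = + (n C k) * a ^ (n ∸ k) * g (suc k)
    Y k = + (n C suc k) * a ^ (n ∸ k) * g (suc k)
    Z k = + (n C k) * a ^ (suc n ∸ k) * g k
    W k = + (n C k) * a ^ (n ∸ k) * g k
    distribʳ : ∀ x y u v → (x + y) * u * v ≡ x * u * v + y * u * v
    distribʳ = solve-∀
    pascal : ∀ k → + (suc n C suc k) * a ^ (n ∸ k) * g (suc k) ≡ X k + Y k
    pascal k = trans (cong (λ c → + c * a ^ (n ∸ k) * g (suc k)) (sym (nCk+nC[k+1]≡[n+1]C[k+1] n k)))
                     (distribʳ (+ (n C k)) (+ (n C suc k)) (a ^ (n ∸ k)) (g (suc k)))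
    +-exchange : ∀ x y z → x + (y + z) ≡ y + (x + z)
    +-exchange = solve-∀
    Z-last : Z (suc n) ≡ + 0
    Z-last rewrite k>n⇒nCk≡0 (ℕ.n<1+n n) = refl
    pull-a : ∀ c a w g → c * (a * w) * g ≡ a * (c * w * g)
    pull-a = solve-∀
    Z≡aW : ∀ k → k < suc n → Z k ≡ a * W k
    Z≡aW k (s≤s k≤n) rewrite ℕ.+-∸-assoc 1 k≤n = pull-a (+ (n C k)) a (a ^ (n ∸ k)) (g k)

  binomial : ∀ {T} → IsLinear T → ∀ a n f m → ((T ⊕ a) ^[ n ]) f m ≡ binomialSum n a (λ k → (T ^[ k ]) f m)
  binomial T-linear a zero    f m = sym (unit (f m))
    where
    unit : ∀ x → + 0 + + 1 * + 1 * x ≡ x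
    unit = solve-∀
  binomial {T} T-linear a (suc n) f m = begin
    ((T ⊕ a) ^[ n ]) (T f ⊞ a ⊡ f) m
      ≡⟨ ⊞-homo Tₐⁿ-linear (T f) (a ⊡ f) m ⟩
    ((T ⊕ a) ^[ n ]) (T f) m + ((T ⊕ a) ^[ n ]) (a ⊡ f) m
      ≡⟨ cong (λ z → ((T ⊕ a) ^[ n ]) (T f) m + z) (⊡-homo Tₐⁿ-linear a f m) ⟩
    ((T ⊕ a) ^[ n ]) (T f) m + a * ((T ⊕ a) ^[ n ]) f m
      ≡⟨ cong₂ (λ x y → x + a * y) (binomial T-linear a n (T f) m) (binomial T-linear a n f m) ⟩
    binomialSum n a (λ k → (T ^[ suc k ]) f m) + a * binomialSum n a (λ k → (T ^[ k ]) f m)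
      ≡⟨ binomialSum-suc n a (λ k → (T ^[ k ]) f m) ⟩
    binomialSum (suc n) a (λ k → (T ^[ k ]) f m) ∎
    where
    open ≡-Reasoning
    Tₐⁿ-linear = ^[]-linear (⊕-linear T-linear a) n

  -- Bell numbers as an umbral functional

  bell : Seq
  bell n = + Bell n

  -- The summand of the recurrence in Defs is local to bellVec; this exposes it to computation.
  Bell-suc-summand : ∀ n → Σ[ G ∈ (ℕ → ℕ) ] Bell (suc n) ≡ sumℕ (suc n) G
  Bell-suc-summand n = _ , refl

  lookup-bellVec : ∀ n (i : Fin (suc n)) → lookup (bellVec n) i ≡ Bell (n ∸ toℕ i)
  lookup-bellVec zero    zero    = refl
  lookup-bellVec (suc n) zero    = refl
  lookup-bellVec (suc n) (suc i) = lookup-bellVec n i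

  Bell-suc-summand-value : ∀ n k → k < suc n → proj₁ (Bell-suc-summand n) k ≡ (n C k) ℕ.* Bell k
  Bell-suc-summand-value n k k<1+n with k <? suc n
  ... | no  k≮1+n = contradiction k<1+n k≮1+n
  ... | yes k<1+n′ = cong ((n C k) ℕ.*_) (trans (lookup-bellVec n _) (cong Bell n∸[n∸k]≡k))
    where
    n∸[n∸k]≡k : n ∸ toℕ (opposite (fromℕ< k<1+n′)) ≡ k
    n∸[n∸k]≡k = begin
      n ∸ toℕ (opposite (fromℕ< k<1+n′))  ≡⟨ cong (n ∸_) (Fin.opposite-prop (fromℕ< k<1+n′)) ⟩
      n ∸ (n ∸ toℕ (fromℕ< k<1+n′))       ≡⟨ cong (λ i → n ∸ (n ∸ i)) (Fin.toℕ-fromℕ< k<1+n′) ⟩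
      n ∸ (n ∸ k)                         ≡⟨ ℕ.m∸[m∸n]≡n (ℕ.≤-pred k<1+n) ⟩
      k                                   ∎
      where open ≡-Reasoning

  bell-suc : ∀ n → bell (suc n) ≡ sumℤ (suc n) (λ k → + (n C k) * bell k)
  bell-suc n = trans (+-sumℕ (suc n) _) (sumℤ-cong (suc n) (λ k k<1+n →
    trans (cong +_ (Bell-suc-summand-value n k k<1+n)) (ℤ.pos-* (n C k) (Bell k))))

  E⊕-^[]-at-0 : ∀ a n f → ((E ⊕ a) ^[ n ]) f 0 ≡ binomialSum n a f
  E⊕-^[]-at-0 a n f = trans (binomial E-linear a n f 0) (sumℤ-cong (suc n) (λ k _ →
    cong (λ z → + (n C k) * a ^ (n ∸ k) * z) (trans (E^[]-apply k f 0) (cong f (ℕ.+-identityʳ k)))))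

  rBell-as-operator : ∀ n a → rBell n a ≡ ((E ⊕ a) ^[ n ]) bell 0
  rBell-as-operator n a = sym (E⊕-^[]-at-0 a n bell)

  bell-suc-as-operator : ∀ n → bell (suc n) ≡ ((E ⊕ + 1) ^[ n ]) bell 0
  bell-suc-as-operator n = trans (bell-suc n) (sym (trans (E⊕-^[]-at-0 (+ 1) n bell) (sumℤ-cong (suc n) (λ k _ →
    trans (cong (λ z → + (n C k) * z * bell k) (ℤ.^-zeroˡ (n ∸ k))) (cong (_* bell k) (ℤ.*-identityʳ (+ (n C k))))))))

  Π⊕ : List ℤ → Op
  Π⊕ []       f = f
  Π⊕ (c ∷ cs) f = (E ⊕ c) (Π⊕ cs f)

  Π⊕-linear : ∀ cs → IsLinear (Π⊕ cs)
  Π⊕-linear []       = id-linear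
  Π⊕-linear (c ∷ cs) = ∘-linear (⊕-linear E-linear c) (Π⊕-linear cs)

  Π⊕-commutesWithE : ∀ cs → CommutesWithE (Π⊕ cs)
  Π⊕-commutesWithE []       f = refl
  Π⊕-commutesWithE (c ∷ cs) f = cong (E ⊕ c) (Π⊕-commutesWithE cs f)

  Π⊕-++ : ∀ cs ds f → Π⊕ (cs ++ ds) f ≡ Π⊕ cs (Π⊕ ds f)
  Π⊕-++ []       ds f = refl
  Π⊕-++ (c ∷ cs) ds f = cong (E ⊕ c) (Π⊕-++ cs ds f)

  Π⊕-replicate : ∀ n c f → Π⊕ (replicate n c) f ≡ ((E ⊕ c) ^[ n ]) f
  Π⊕-replicate zero    c f = refl
  Π⊕-replicate (suc n) c f = trans (cong (E ⊕ c) (Π⊕-replicate n c f)) (sym (^[]-suc n (E ⊕ c) f))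

  -- Umbrally, with B_n = L(x^n): L(x^(m+1) P(x)) = L((x+1)^m P(x+1)) for P = Π (x + c).
  Π⊕-bell-suc : ∀ cs m → Π⊕ cs bell (suc m) ≡ ((E ⊕ + 1) ^[ m ]) (Π⊕ (map ℤ.suc cs) bell) 0
  Π⊕-bell-suc []       m = bell-suc-as-operator m
  Π⊕-bell-suc (c ∷ cs) m = begin
    Π⊕ cs bell (suc (suc m)) + c * Π⊕ cs bell (suc m)
      ≡⟨ cong₂ (λ u v → u + c * v) (Π⊕-bell-suc cs (suc m)) (Π⊕-bell-suc cs m) ⟩
    A ((E ⊕ + 1) g) 0 + c * A g 0
      ≡⟨ cong (λ z → A ((E ⊕ + 1) g) 0 + z) (sym (⊡-homo A-linear c g 0)) ⟩
    A ((E ⊕ + 1) g) 0 + A (c ⊡ g) 0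
      ≡⟨ sym (⊞-homo A-linear ((E ⊕ + 1) g) (c ⊡ g) 0) ⟩
    A ((E ⊕ + 1) g ⊞ c ⊡ g) 0
      ≡⟨ ≗-cong A-linear (λ j → regroup (g (suc j)) (g j) c) 0 ⟩
    A ((E ⊕ ℤ.suc c) g) 0 ∎
    where
    open ≡-Reasoning
    g = Π⊕ (map ℤ.suc cs) bell
    A = (E ⊕ + 1) ^[ m ]
    A-linear = ^[]-linear (⊕-linear E-linear (+ 1)) m
    regroup : ∀ x y c → x + + 1 * y + c * y ≡ x + (+ 1 + c) * y
    regroup = solve-∀

  Π⊕-bell-shift : ∀ cs → Π⊕ cs bell 1 ≡ Π⊕ (map ℤ.suc cs) bell 0
  Π⊕-bell-shift cs = Π⊕-bell-suc cs 0

  fallingRoots : ℕ → List ℤ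
  fallingRoots zero    = []
  fallingRoots (suc k) = - + k ∷ fallingRoots k

  falling : ℕ → Op
  falling k = Π⊕ (fallingRoots k)

  fallingRoots-suc : ∀ k → fallingRoots (suc k) ≡ map ℤ.pred (fallingRoots k) ++ + 0 ∷ []
  fallingRoots-suc zero    = refl
  fallingRoots-suc (suc k) = cong₂ _∷_ (-[1+x]≡-1+-x (+ k)) (fallingRoots-suc k)
    where
    -[1+x]≡-1+-x : ∀ x → - (+ 1 + x) ≡ - + 1 + - x
    -[1+x]≡-1+-x = solve-∀

  falling-bell : ∀ k → falling k bell 0 ≡ + 1
  falling-bell zero    = refl
  falling-bell (suc k) = begin
    Π⊕ (fallingRoots (suc k)) bell 0
      ≡⟨ cong (λ cs → Π⊕ cs bell 0) (fallingRoots-suc k) ⟩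
    Π⊕ (map ℤ.pred roots ++ + 0 ∷ []) bell 0
      ≡⟨ cong (λ h → h 0) (Π⊕-++ (map ℤ.pred roots) (+ 0 ∷ []) bell) ⟩
    Π⊕ (map ℤ.pred roots) ((E ⊕ + 0) bell) 0
      ≡⟨ ≗-cong (Π⊕-linear (map ℤ.pred roots)) (λ j → ℤ.+-identityʳ (bell (suc j))) 0 ⟩
    Π⊕ (map ℤ.pred roots) (E bell) 0
      ≡⟨ cong (λ h → h 0) (Π⊕-commutesWithE (map ℤ.pred roots) bell) ⟩
    Π⊕ (map ℤ.pred roots) bell 1
      ≡⟨ Π⊕-bell-shift (map ℤ.pred roots) ⟩
    Π⊕ (map ℤ.suc (map ℤ.pred roots)) bell 0
      ≡⟨ cong (λ cs → Π⊕ cs bell 0) (map-suc-pred roots) ⟩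
    Π⊕ roots bell 0
      ≡⟨ falling-bell k ⟩
    + 1 ∎
    where
    open ≡-Reasoning
    roots = fallingRoots k
    map-suc-pred : ∀ cs → map ℤ.suc (map ℤ.pred cs) ≡ cs
    map-suc-pred cs = trans (sym (map-∘ cs)) (trans (map-cong ℤ.suc-pred cs) (map-id cs))

  -- Stirling numbers and finite differences

  Stirling : ℕ → ℕ → ℤ
  Stirling zero    zero    = + 1
  Stirling zero    (suc k) = + 0
  Stirling (suc n) zero    = + 0
  Stirling (suc n) (suc k) = Stirling n k + + suc k * Stirling n (suc k)

  Stirling-above-diagonal : ∀ {n k} → n < k → Stirling n k ≡ + 0
  Stirling-above-diagonal {zero}  {suc k} _ = refl
  Stirling-above-diagonal {suc n} {suc k} (s≤s n<k)
    rewrite Stirling-above-diagonal n<k | Stirling-above-diagonal (ℕ.m<n⇒m<1+n n<k)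
    = trans (ℤ.+-identityˡ _) (ℤ.*-zeroʳ (+ suc k))

  Stirling-diagonal : ∀ n → Stirling n n ≡ + 1
  Stirling-diagonal zero    = refl
  Stirling-diagonal (suc n)
    rewrite Stirling-diagonal n | Stirling-above-diagonal (ℕ.n<1+n n)
    = trans (cong ℤ.suc (ℤ.*-zeroʳ (+ suc n))) (ℤ.+-identityʳ (+ 1))

  E-falling : ∀ k f → E (falling k f) ≗ falling (suc k) f ⊞ + k ⊡ falling k f
  E-falling k f m = shift-out (falling k f (suc m)) (falling k f m) (+ k)
    where
    shift-out : ∀ y z k → y ≡ y + - k * z + k * z
    shift-out = solve-∀

  E^[]-falling-expansion : ∀ n f m → (E ^[ n ]) f m ≡ sumℤ (suc n) (λ k → Stirling n k * falling k f m)
  E^[]-falling-expansion zero f m = sym (trans (ℤ.+-identityˡ _) (ℤ.*-identityˡ (f m)))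
  E^[]-falling-expansion (suc n) f m = begin
    (E ^[ n ]) (E f) m
      ≡⟨ E^[]-falling-expansion n (E f) m ⟩
    sumℤ (suc n) (λ k → Stirling n k * falling k (E f) m)
      ≡⟨ sumℤ-cong (suc n) (λ k _ → trans (cong (λ h → Stirling n k * h m) (Π⊕-commutesWithE (fallingRoots k) f))
                                           (trans (cong (Stirling n k *_) (E-falling k f m)) (split (Stirling n k) _ _ (+ k)))) ⟩
    sumℤ (suc n) (λ k → up k + stay k)
      ≡⟨ sumℤ-+ (suc n) up stay ⟩
    sumℤ (suc n) up + sumℤ (suc n) stay
      ≡⟨ cong (λ z → sumℤ (suc n) up + z) (sumℤ-suc-head n stay) ⟩
    sumℤ (suc n) up + (stay 0 + sumℤ n (λ k → stay (suc k)))
      ≡⟨ cong (λ z → sumℤ (suc n) up + z) (drop-first (sumℤ n (λ k → stay (suc k))) (Stirling n 0 * falling 0 f m)) ⟩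
    sumℤ (suc n) up + (sumℤ n (λ k → stay (suc k)) + + 0)
      ≡⟨ cong (λ z → sumℤ (suc n) up + (sumℤ n (λ k → stay (suc k)) + z)) (sym stay-last) ⟩
    sumℤ (suc n) up + sumℤ (suc n) (λ k → stay (suc k))
      ≡⟨ sym (sumℤ-+ (suc n) up (λ k → stay (suc k))) ⟩
    sumℤ (suc n) (λ k → up k + stay (suc k))
      ≡⟨ sumℤ-cong (suc n) (λ k _ → collect (Stirling n k) (Stirling n (suc k)) (+ suc k) (falling (suc k) f m)) ⟩
    sumℤ (suc n) shifted
      ≡⟨ sym (trans (sumℤ-suc-head (suc n) _) (trans (cong (_+ sumℤ (suc n) shifted) (ℤ.*-zeroˡ (f m))) (ℤ.+-identityˡ _))) ⟩
    sumℤ (suc (suc n)) (λ k → Stirling (suc n) k * falling k f m) ∎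
    where
    open ≡-Reasoning
    up stay shifted : ℕ → ℤ
    up k   = Stirling n k * falling (suc k) f m
    shifted k = Stirling (suc n) (suc k) * falling (suc k) f m
    stay k = + k * (Stirling n k * falling k f m)
    split : ∀ s y z k → s * (y + k * z) ≡ s * y + k * (s * z)
    split = solve-∀
    drop-first : ∀ x y → + 0 * y + x ≡ x + + 0
    drop-first = solve-∀
    stay-last : stay (suc n) ≡ + 0
    stay-last rewrite Stirling-above-diagonal (ℕ.n<1+n n) = ℤ.*-zeroʳ (+ suc n)
    collect : ∀ a b k y → a * y + k * (b * y) ≡ (a + k * b) * y
    collect = solve-∀

  bell≡sum-Stirling : ∀ n → bell n ≡ sumℤ (suc n) (Stirling n)
  bell≡sum-Stirling n = begin
    bell n
      ≡⟨ cong bell (sym (ℕ.+-identityʳ n)) ⟩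
    bell (n ℕ.+ 0)
      ≡⟨ sym (E^[]-apply n bell 0) ⟩
    (E ^[ n ]) bell 0
      ≡⟨ E^[]-falling-expansion n bell 0 ⟩
    sumℤ (suc n) (λ k → Stirling n k * falling k bell 0)
      ≡⟨ sumℤ-cong (suc n) (λ k _ → trans (cong (Stirling n k *_) (falling-bell k)) (ℤ.*-identityʳ (Stirling n k))) ⟩
    sumℤ (suc n) (Stirling n) ∎
    where open ≡-Reasoning

  Δ : Op
  Δ = E ⊕ - + 1

  Δ-linear : IsLinear Δ
  Δ-linear = ⊕-linear E-linear (- + 1)

  X : Op
  X h j = + j * h j

  Δ-X : ∀ h → Δ (X h) ≗ X (Δ h) ⊞ E h
  Δ-X h j = product-rule (+ j) (h (suc j)) (h j)
    where
    product-rule : ∀ x a b → (+ 1 + x) * a + - + 1 * (x * b) ≡ x * (a + - + 1 * b) + a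
    product-rule = solve-∀

  Δ^[]-X : ∀ k h j → (Δ ^[ suc k ]) (X h) j ≡ + j * (Δ ^[ suc k ]) h j + + suc k * (Δ ^[ k ]) h (suc j)
  Δ^[]-X zero    h j = trans (Δ-X h j) (cong (λ z → + j * Δ h j + z) (sym (ℤ.*-identityˡ (h (suc j)))))
  Δ^[]-X (suc k) h j = begin
    (Δ ^[ suc k ]) (Δ (X h)) j
      ≡⟨ ≗-cong (^[]-linear Δ-linear (suc k)) (Δ-X h) j ⟩
    (Δ ^[ suc k ]) (X (Δ h) ⊞ E h) j
      ≡⟨ ⊞-homo (^[]-linear Δ-linear (suc k)) (X (Δ h)) (E h) j ⟩
    (Δ ^[ suc k ]) (X (Δ h)) j + (Δ ^[ suc k ]) (E h) j
      ≡⟨ cong₂ _+_ (Δ^[]-X k (Δ h) j) (cong (λ g → g j) (E⊕^[]-commutesWithE (- + 1) (suc k) h)) ⟩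
    + j * (Δ ^[ suc (suc k) ]) h j + + suc k * (Δ ^[ suc k ]) h (suc j) + (Δ ^[ suc k ]) h (suc j)
      ≡⟨ absorb (+ j) ((Δ ^[ suc (suc k) ]) h j) (+ k) ((Δ ^[ suc k ]) h (suc j)) ⟩
    + j * (Δ ^[ suc (suc k) ]) h j + + suc (suc k) * (Δ ^[ suc k ]) h (suc j) ∎
    where
    open ≡-Reasoning
    absorb : ∀ x a k b → x * a + (+ 1 + k) * b + b ≡ x * a + (+ 1 + (+ 1 + k)) * b
    absorb = solve-∀

  Δ^[]-const : ∀ k x → (Δ ^[ suc k ]) (λ _ → x) 0 ≡ + 0
  Δ^[]-const k x = trans (≗-cong (^[]-linear Δ-linear k) (λ _ → x-x≡0 x) 0) (Δ^[]-zero k)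
    where
    x-x≡0 : ∀ x → x + - + 1 * x ≡ + 0
    x-x≡0 = solve-∀
    Δ^[]-zero : ∀ k → (Δ ^[ k ]) (λ _ → + 0) 0 ≡ + 0
    Δ^[]-zero zero    = refl
    Δ^[]-zero (suc k) = Δ^[]-zero k

  powers : ℕ → Seq
  powers n j = (+ j) ^ n

  Δ^[]-powers-suc : ∀ n k → (Δ ^[ suc k ]) (powers (suc n)) 0 ≡ + suc k * ((Δ ^[ suc k ]) (powers n) 0 + (Δ ^[ k ]) (powers n) 0)
  Δ^[]-powers-suc n k = begin
    (Δ ^[ suc k ]) (X (powers n)) 0
      ≡⟨ Δ^[]-X k (powers n) 0 ⟩
    + 0 * (Δ ^[ suc k ]) (powers n) 0 + + suc k * (Δ ^[ k ]) (powers n) 1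
      ≡⟨ cong (λ z → + 0 * (Δ ^[ suc k ]) (powers n) 0 + + suc k * z) E-as-Δ ⟩
    + 0 * (Δ ^[ suc k ]) (powers n) 0 + + suc k * (next + here)
      ≡⟨ drop-zero ((Δ ^[ suc k ]) (powers n) 0) _ ⟩
    + suc k * (next + here) ∎
    where
    open ≡-Reasoning
    next = (Δ ^[ suc k ]) (powers n) 0
    here = (Δ ^[ k ]) (powers n) 0
    drop-zero : ∀ a b → + 0 * a + b ≡ b
    drop-zero = solve-∀
    E≗Δ+id : ∀ a b → a ≡ (a + - + 1 * b) + b
    E≗Δ+id = solve-∀
    E-as-Δ : (Δ ^[ k ]) (powers n) 1 ≡ next + here
    E-as-Δ = begin
      (Δ ^[ k ]) (powers n) 1           ≡⟨ cong (λ g → g 0) (sym (E⊕^[]-commutesWithE (- + 1) k (powers n))) ⟩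
      (Δ ^[ k ]) (E (powers n)) 0       ≡⟨ ≗-cong (^[]-linear Δ-linear k) (λ j → E≗Δ+id (powers n (suc j)) (powers n j)) 0 ⟩
      (Δ ^[ k ]) (Δ (powers n) ⊞ powers n) 0 ≡⟨ ⊞-homo (^[]-linear Δ-linear k) (Δ (powers n)) (powers n) 0 ⟩
      next + here                       ∎

  Δ^[]-powers : ∀ n k → (Δ ^[ k ]) (powers n) 0 ≡ + (k !) * Stirling n k
  Δ^[]-powers zero    zero    = refl
  Δ^[]-powers zero    (suc k) = trans (Δ^[]-const k (+ 1)) (sym (ℤ.*-zeroʳ (+ (suc k !))))
  Δ^[]-powers (suc n) zero    = refl
  Δ^[]-powers (suc n) (suc k) = begin
    (Δ ^[ suc k ]) (powers (suc n)) 0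
      ≡⟨ Δ^[]-powers-suc n k ⟩
    + suc k * ((Δ ^[ suc k ]) (powers n) 0 + (Δ ^[ k ]) (powers n) 0)
      ≡⟨ cong₂ (λ u v → + suc k * (u + v)) (Δ^[]-powers n (suc k)) (Δ^[]-powers n k) ⟩
    + suc k * (+ (suc k !) * Stirling n (suc k) + + (k !) * Stirling n k)
      ≡⟨ cong (λ z → + suc k * (z * Stirling n (suc k) + + (k !) * Stirling n k)) (ℤ.pos-* (suc k) (k !)) ⟩
    + suc k * (+ suc k * + (k !) * Stirling n (suc k) + + (k !) * Stirling n k)
      ≡⟨ factor (+ suc k) (+ (k !)) (Stirling n (suc k)) (Stirling n k) ⟩
    + suc k * + (k !) * Stirling (suc n) (suc k)
      ≡⟨ cong (_* Stirling (suc n) (suc k)) (sym (ℤ.pos-* (suc k) (k !))) ⟩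
    + (suc k !) * Stirling (suc n) (suc k) ∎
    where
    open ≡-Reasoning
    factor : ∀ a f x y → a * (a * f * x + f * y) ≡ a * f * (y + a * x)
    factor = solve-∀

  module Congruence (m : ℕ) where

    -- A record rather than a bare divisibility, so that a and b can be recovered by unification.
    infix 4 _≈_
    record _≈_ (a b : ℤ) : Set where
      constructor mod
      field modulus-divides : + m ∣ a - b
    open _≈_ public

    ≈-fromEquation : ∀ {a b} t → a ≡ b + t * + m → a ≈ b
    ≈-fromEquation {a} {b} t a≡b+tm = mod (divides t (trans (cong (_- b) a≡b+tm) (cancel b (t * + m))))
      where
      cancel : ∀ b c → b + c - b ≡ c
      cancel = solve-∀

    ≈-toEquation : ∀ {a b} → a ≈ b → Σ[ t ∈ ℤ ] a ≡ b + t * + m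
    ≈-toEquation {a} {b} (mod (divides t a-b≡tm)) = t , trans (split a b) (cong (λ d → b + d) a-b≡tm)
      where
      split : ∀ a b → a ≡ b + (a - b)
      split = solve-∀

    ≈-reflexive : ∀ {a b} → a ≡ b → a ≈ b
    ≈-reflexive {a} refl = ≈-fromEquation (+ 0) (sym (ℤ.+-identityʳ a))

    ≈-refl : ∀ {a} → a ≈ a
    ≈-refl = ≈-reflexive refl

    ≈-sym : ∀ {a b} → a ≈ b → b ≈ a
    ≈-sym {a} {b} a≈b with ≈-toEquation a≈b
    ... | t , refl = ≈-fromEquation (- t) (flip b t (+ m))
      where
      flip : ∀ b t M → b ≡ b + t * M + - t * M
      flip = solve-∀

    ≈-trans : ∀ {a b c} → a ≈ b → b ≈ c → a ≈ c
    ≈-trans {c = c} a≈b b≈c with ≈-toEquation a≈b | ≈-toEquation b≈c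
    ... | s , refl | t , refl = ≈-fromEquation (t + s) (collect c t s (+ m))
      where
      collect : ∀ c t s M → c + t * M + s * M ≡ c + (t + s) * M
      collect = solve-∀

    ≈-isEquivalence : IsEquivalence _≈_
    ≈-isEquivalence = record { refl = ≈-refl ; sym = ≈-sym ; trans = ≈-trans }

    ≈-setoid : Setoid _ _
    ≈-setoid = record { isEquivalence = ≈-isEquivalence }

    +-cong : ∀ {a b c d} → a ≈ b → c ≈ d → a + c ≈ b + d
    +-cong {b = b} {d = d} a≈b c≈d with ≈-toEquation a≈b | ≈-toEquation c≈d
    ... | s , refl | t , refl = ≈-fromEquation (s + t) (collect b d s t (+ m))
      where
      collect : ∀ b d s t M → b + s * M + (d + t * M) ≡ b + d + (s + t) * M
      collect = solve-∀

    *-congˡ : ∀ c {a b} → a ≈ b → c * a ≈ c * b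
    *-congˡ c {b = b} a≈b with ≈-toEquation a≈b
    ... | t , refl = ≈-fromEquation (c * t) (distrib c b t (+ m))
      where
      distrib : ∀ c b t M → c * (b + t * M) ≡ c * b + c * t * M
      distrib = solve-∀

    *-congʳ : ∀ c {a b} → a ≈ b → a * c ≈ b * c
    *-congʳ c {a} {b} a≈b = ≈-trans (≈-reflexive (ℤ.*-comm a c)) (≈-trans (*-congˡ c a≈b) (≈-reflexive (ℤ.*-comm c b)))

    sumℤ-≈ : ∀ n {f g : ℕ → ℤ} → (∀ k → k < n → f k ≈ g k) → sumℤ n f ≈ sumℤ n g
    sumℤ-≈ zero    f≈g = ≈-refl
    sumℤ-≈ (suc n) f≈g = +-cong (sumℤ-≈ n (λ k k<n → f≈g k (ℕ.m<n⇒m<1+n k<n))) (f≈g n ℕ.≤-refl)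

    +-cancelˡ-≈ : ∀ a {x y} → a + x ≈ a + y → x ≈ y
    +-cancelˡ-≈ a {x} {y} a+x≈a+y with ≈-toEquation a+x≈a+y
    ... | t , a+x≡a+y+tm = ≈-fromEquation t (begin
      x                          ≡⟨ unfold a x ⟩
      - a + (a + x)              ≡⟨ cong (λ z → - a + z) a+x≡a+y+tm ⟩
      - a + (a + y + t * + m)    ≡⟨ cancel a y (t * + m) ⟩
      y + t * + m                ∎)
      where
      open ≡-Reasoning
      unfold : ∀ a x → x ≡ - a + (a + x)
      unfold = solve-∀
      cancel : ∀ a y z → - a + (a + y + z) ≡ y + z
      cancel = solve-∀

    ∣⇒≈0 : ∀ {a} → + m ∣ a → a ≈ + 0
    ∣⇒≈0 {a} m∣a = mod (subst (+ m ∣_) (sym (ℤ.+-identityʳ a)) m∣a)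

    sumℤ-≈0 : ∀ n {f : ℕ → ℤ} → (∀ k → k < n → f k ≈ + 0) → sumℤ n f ≈ + 0
    sumℤ-≈0 zero    f≈0 = ≈-refl
    sumℤ-≈0 (suc n) f≈0 = +-cong (sumℤ-≈0 n (λ k k<n → f≈0 k (ℕ.m<n⇒m<1+n k<n))) (f≈0 n ℕ.≤-refl)

    binomialSum-≈-ends : ∀ n a g → 0 < n → (∀ k → 0 < k → k < n → + m ∣ + (n C k)) →
                         binomialSum n a g ≈ a ^ n * g 0 + g n
    binomialSum-≈-ends (suc n) a g _ m∣C = begin
      binomialSum (suc n) a g
        ≡⟨ sumℤ-suc-head (suc n) F ⟩
      F 0 + (sumℤ n (λ k → F (suc k)) + F (suc n))
        ≈⟨ +-cong (≈-refl {F 0}) (+-cong inner≈0 (≈-refl {F (suc n)})) ⟩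
      F 0 + (+ 0 + F (suc n))
        ≡⟨ cong₂ (λ x y → x + (+ 0 + y)) first last ⟩
      a ^ suc n * g 0 + (+ 0 + g (suc n))
        ≡⟨ cong (λ z → a ^ suc n * g 0 + z) (ℤ.+-identityˡ (g (suc n))) ⟩
      a ^ suc n * g 0 + g (suc n) ∎
      where
      open import Relation.Binary.Reasoning.Setoid ≈-setoid
      F : ℕ → ℤ
      F k = + (suc n C k) * a ^ (suc n ∸ k) * g k
      inner≈0 : sumℤ n (λ k → F (suc k)) ≈ + 0
      inner≈0 = sumℤ-≈0 n (λ k k<n →
        ∣⇒≈0 (∣m⇒∣m*n (g (suc k)) (∣m⇒∣m*n (a ^ (n ∸ k)) (m∣C (suc k) (s≤s z≤n) (s≤s k<n)))))
      unit : ∀ x y → + 1 * x * y ≡ x * y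
      unit = solve-∀
      first : F 0 ≡ a ^ suc n * g 0
      first = unit (a ^ suc n) (g 0)
      last : F (suc n) ≡ g (suc n)
      last rewrite nCn≡1 (suc n) | ℕ.n∸n≡0 n = trans (cong (_* g (suc n)) (ℤ.*-identityʳ (+ 1))) (ℤ.*-identityˡ (g (suc n)))

    infix 4 _≋_
    _≋_ : Seq → Seq → Set
    f ≋ g = ∀ k → f k ≈ g k

    linear-≈-cong : ∀ {T} → IsLinear T → ∀ {f g} → f ≋ g → T f ≋ T g
    linear-≈-cong {T} T-linear {f} {g} f≋g k =
      ≈-fromEquation (T t k) (begin
        T f k                 ≡⟨ ≗-cong T-linear f≗g+mt k ⟩
        T (g ⊞ + m ⊡ t) k     ≡⟨ ⊞-homo T-linear g (+ m ⊡ t) k ⟩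
        T g k + T (+ m ⊡ t) k ≡⟨ cong (λ z → T g k + z) (trans (⊡-homo T-linear (+ m) t k) (ℤ.*-comm (+ m) (T t k))) ⟩
        T g k + T t k * + m   ∎)
      where
      open ≡-Reasoning
      t : Seq
      t j = proj₁ (≈-toEquation (f≋g j))
      f≗g+mt : f ≗ g ⊞ + m ⊡ t
      f≗g+mt j = trans (proj₂ (≈-toEquation (f≋g j))) (cong (λ z → g j + z) (ℤ.*-comm (t j) (+ m)))

  module PrimeModulus {p : ℕ} (p-prime : Prime p) where
    open Congruence p public
    open import Relation.Binary.Reasoning.Setoid ≈-setoid

    prime∤! : ∀ {k} → k < p → ¬ p ℕ.∣ k !
    prime∤! {zero}  _   p∣1  = ¬prime[1] (subst Prime (ℕ.∣1⇒≡1 p∣1) p-prime)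
    prime∤! {suc k} k<p p∣k! with euclidsLemma (suc k) (k !) p-prime p∣k!
    ... | inj₁ p∣1+k = ℕ.<⇒≱ k<p (ℕ.∣⇒≤ p∣1+k)
    ... | inj₂ p∣k!  = prime∤! (ℕ.<-trans (ℕ.n<1+n k) k<p) p∣k!

    prime∣C : ∀ {j} → 0 < j → j < p → + p ∣ + (p C j)
    prime∣C {j} 0<j j<p = ∣ᵤ⇒∣ (subst (p ℕ.∣_) (sym p-C-j≡quotient) p∣quotient)
      where
      j≤p = ℕ.<⇒≤ j<p
      instance _ = ℕ._!*_!≢0 j (p ∸ j)
      denominator∣p! : (j ! ℕ.* (p ∸ j) !) ℕ.∣ p !
      denominator∣p! = k![n∸k]!∣n! j≤p
      p-C-j≡quotient : p C j ≡ ℕ.quotient denominator∣p!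
      p-C-j≡quotient = trans (nCk≡n!/k![n-k]! j≤p) (ℕ.n/m≡quotient denominator∣p!)
      n∣n! : ∀ n → 0 < n → n ℕ.∣ n !
      n∣n! (suc n) _ = ℕ.m∣m*n (n !)
      p∣quotient : p ℕ.∣ ℕ.quotient denominator∣p!
      p∣quotient*denominator : p ℕ.∣ ℕ.quotient denominator∣p! ℕ.* (j ! ℕ.* (p ∸ j) !)
      p∣quotient*denominator = subst (p ℕ.∣_) (ℕ.m∣n⇒n≡quotient*m denominator∣p!) (n∣n! p (ℕ.<-trans 0<j j<p))
      p∣quotient with euclidsLemma _ _ p-prime p∣quotient*denominator
      ... | inj₁ p∣q = p∣q
      ... | inj₂ p∣j![p∸j]! with euclidsLemma (j !) ((p ∸ j) !) p-prime p∣j![p∸j]!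
      ...   | inj₁ p∣j!     = contradiction p∣j! (prime∤! j<p)
      ...   | inj₂ p∣[p∸j]! = contradiction p∣[p∸j]! (prime∤! (ℕ.∸-monoʳ-< {p} {j} {0} 0<j j≤p))

    *-cancelˡ-≈ : ∀ c {x y} → ¬ p ℕ.∣ c → + c * x ≈ + c * y → x ≈ y
    *-cancelˡ-≈ c {x} {y} p∤c (mod p∣cx-cy) = mod (∣ᵤ⇒∣ p∣∣x-y∣)
      where
      factor : ∀ c x y → c * x - c * y ≡ c * (x - y)
      factor = solve-∀
      p∣c∣x-y∣ : p ℕ.∣ c ℕ.* ℤ.∣ x - y ∣
      p∣c∣x-y∣ = subst (p ℕ.∣_) (trans (cong ℤ.∣_∣ (factor (+ c) x y)) (ℤ.abs-* (+ c) (x - y))) (∣⇒∣ᵤ p∣cx-cy)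
      p∣∣x-y∣ : p ℕ.∣ ℤ.∣ x - y ∣
      p∣∣x-y∣ with euclidsLemma c ℤ.∣ x - y ∣ p-prime p∣c∣x-y∣
      ... | inj₁ p∣c     = contradiction p∣c p∤c
      ... | inj₂ p∣∣x-y∣ = p∣∣x-y∣

    1<p : 1 < p
    1<p = ℕ.nonTrivial⇒n>1 p {{prime⇒nonTrivial p-prime}}

    0<p : 0 < p
    0<p = ℕ.<-trans (s≤s z≤n) 1<p

    frobenius : ∀ {T} → IsLinear T → ∀ a f m → ((T ⊕ a) ^[ p ]) f m ≈ (T ^[ p ]) f m + a ^ p * f m
    frobenius {T} T-linear a f m = begin
      ((T ⊕ a) ^[ p ]) f m                        ≡⟨ binomial T-linear a p f m ⟩
      binomialSum p a (λ k → (T ^[ k ]) f m)       ≈⟨ binomialSum-≈-ends p a _ 0<p (λ k → prime∣C) ⟩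
      a ^ p * f m + (T ^[ p ]) f m                 ≡⟨ ℤ.+-comm (a ^ p * f m) _ ⟩
      (T ^[ p ]) f m + a ^ p * f m                 ∎

    E⊕^[]-const : ∀ c k x m → ((E ⊕ c) ^[ k ]) (λ _ → x) m ≡ (+ 1 + c) ^ k * x
    E⊕^[]-const c zero    x m = sym (ℤ.*-identityˡ x)
    E⊕^[]-const c (suc k) x m = trans (E⊕^[]-const c k (x + c * x) m) (regroup ((+ 1 + c) ^ k) c x)
      where
      regroup : ∀ u c x → u * (x + c * x) ≡ (+ 1 + c) * u * x
      regroup = solve-∀

    [1+c]^p≈1+c^p : ∀ c → (+ 1 + c) ^ p ≈ + 1 + c ^ p
    [1+c]^p≈1+c^p c = begin
      (+ 1 + c) ^ p                                  ≡⟨ sym (ℤ.*-identityʳ _) ⟩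
      (+ 1 + c) ^ p * + 1                            ≡⟨ sym (E⊕^[]-const c p (+ 1) 0) ⟩
      ((E ⊕ c) ^[ p ]) one 0                         ≈⟨ frobenius E-linear c one 0 ⟩
      (E ^[ p ]) one 0 + c ^ p * + 1                 ≡⟨ cong₂ _+_ (E^[]-apply p one 0) (ℤ.*-identityʳ (c ^ p)) ⟩
      + 1 + c ^ p                                    ∎
      where
      one : Seq
      one _ = + 1

    fermat : ∀ c → c ^ p ≈ c
    fermat (+ n)    = fermat-+ n
      where
      fermat-+ : ∀ n → (+ n) ^ p ≈ + n
      fermat-+ zero    = ≈-reflexive (0^n≡0 p 0<p)
        where
        0^n≡0 : ∀ n → 0 < n → (+ 0) ^ n ≡ + 0
        0^n≡0 (suc n) _ = ℤ.*-zeroˡ ((+ 0) ^ n)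
      fermat-+ (suc n) = ≈-trans ([1+c]^p≈1+c^p (+ n)) (+-cong (≈-refl {+ 1}) (fermat-+ n))
    fermat -[1+ n ] = fermat-- (suc n)
      where
      fermat-- : ∀ n → (- + n) ^ p ≈ - + n
      fermat-- zero    = fermat (+ 0)
      fermat-- (suc n) = +-cancelˡ-≈ (+ 1) (begin
        + 1 + (- + suc n) ^ p     ≈⟨ ≈-sym ([1+c]^p≈1+c^p (- + suc n)) ⟩
        (+ 1 + - + suc n) ^ p     ≡⟨ cong (_^ p) (1-[1+n]≡-n (+ n)) ⟩
        (- + n) ^ p               ≈⟨ fermat-- n ⟩
        - + n                     ≡⟨ sym (1-[1+n]≡-n (+ n)) ⟩
        + 1 + - + suc n           ∎)
        where
        1-[1+n]≡-n : ∀ x → + 1 + - (+ 1 + x) ≡ - x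
        1-[1+n]≡-n = solve-∀

    -- Touchard's congruence

    Stirling-prime-≈ : ∀ {k} → k < p → Stirling p k ≈ Stirling 1 k
    Stirling-prime-≈ {k} k<p = *-cancelˡ-≈ (k !) (prime∤! k<p) (begin
      + (k !) * Stirling p k     ≡⟨ sym (Δ^[]-powers p k) ⟩
      (Δ ^[ k ]) (powers p) 0    ≈⟨ linear-≈-cong (^[]-linear Δ-linear k) powers-p≋powers-1 0 ⟩
      (Δ ^[ k ]) (powers 1) 0    ≡⟨ Δ^[]-powers 1 k ⟩
      + (k !) * Stirling 1 k     ∎)
      where
      powers-p≋powers-1 : powers p ≋ powers 1
      powers-p≋powers-1 j = ≈-trans (fermat (+ j)) (≈-reflexive (sym (ℤ.*-identityʳ (+ j))))

    sum-Stirling-1 : ∀ n → 1 < n → sumℤ n (Stirling 1) ≡ + 1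
    sum-Stirling-1 (suc zero)          (s≤s ())
    sum-Stirling-1 (suc (suc zero))    _ = refl
    sum-Stirling-1 (suc (suc (suc n))) _ = trans (cong (_+ Stirling 1 (suc (suc n))) (sum-Stirling-1 (suc (suc n)) (s≤s (s≤s z≤n))))
                                                 (vanish (+ suc (suc n)))
      where
      vanish : ∀ x → + 1 + (+ 0 + x * + 0) ≡ + 1
      vanish = solve-∀

    bell-prime≈2 : bell p ≈ + 2
    bell-prime≈2 = begin
      bell p
        ≡⟨ bell≡sum-Stirling p ⟩
      sumℤ p (Stirling p) + Stirling p p
        ≈⟨ +-cong (sumℤ-≈ p (λ k → Stirling-prime-≈)) (≈-reflexive (Stirling-diagonal p)) ⟩
      sumℤ p (Stirling 1) + + 1
        ≡⟨ cong (_+ + 1) (sum-Stirling-1 p 1<p) ⟩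
      + 2 ∎

    touchardDefect : Seq
    touchardDefect = (E ^[ p ]) bell ⊟ E bell ⊟ bell

    -- B_{m+1+p} = L((x+1)^m (x+1)^p) ≡ L((x+1)^m (x^p + 1)), and likewise for B_{m+2} and B_{m+1}.
    touchardDefect-suc : ∀ m → touchardDefect (suc m) ≈ ((E ⊕ + 1) ^[ m ]) touchardDefect 0
    touchardDefect-suc m = begin
      (E ^[ p ]) bell (suc m) - bell (suc (suc m)) - bell (suc m)
        ≡⟨ cong₂ _-_ (cong₂ _-_ shift-p shift-1) (bell-suc-as-operator m) ⟩
      A (((E ⊕ + 1) ^[ p ]) bell) 0 - A ((E ⊕ + 1) bell) 0 - A bell 0
        ≡⟨ cong (_- A bell 0) (sym (⊟-homo A-linear _ _ 0)) ⟩
      A (((E ⊕ + 1) ^[ p ]) bell ⊟ (E ⊕ + 1) bell) 0 - A bell 0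
        ≡⟨ sym (⊟-homo A-linear _ bell 0) ⟩
      A (((E ⊕ + 1) ^[ p ]) bell ⊟ (E ⊕ + 1) bell ⊟ bell) 0
        ≈⟨ linear-≈-cong A-linear binomial-≋ 0 ⟩
      A touchardDefect 0
        ∎
      where
      A = (E ⊕ + 1) ^[ m ]
      A-linear = ^[]-linear (⊕-linear E-linear (+ 1)) m
      bell-suc-+ : ∀ k → bell (suc (k ℕ.+ m)) ≡ A (((E ⊕ + 1) ^[ k ]) bell) 0
      bell-suc-+ k = trans (bell-suc-as-operator (k ℕ.+ m)) (cong (λ h → h 0) (^[]-+ k m (E ⊕ + 1) bell))
      shift-p : (E ^[ p ]) bell (suc m) ≡ A (((E ⊕ + 1) ^[ p ]) bell) 0
      shift-p = trans (E^[]-apply p bell (suc m)) (trans (cong bell (ℕ.+-suc p m)) (bell-suc-+ p))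
      shift-1 : bell (suc (suc m)) ≡ A ((E ⊕ + 1) bell) 0
      shift-1 = bell-suc-+ 1
      cancel : ∀ a b c → a + + 1 * c - (b + + 1 * c) - c ≡ a - b - c
      cancel = solve-∀
      binomial-≋ : ((E ⊕ + 1) ^[ p ]) bell ⊟ (E ⊕ + 1) bell ⊟ bell ≋ touchardDefect
      binomial-≋ j = begin
        ((E ⊕ + 1) ^[ p ]) bell j - (bell (suc j) + + 1 * bell j) - bell j
          ≈⟨ +-cong (+-cong (frobenius E-linear (+ 1) bell j) ≈-refl) ≈-refl ⟩
        (E ^[ p ]) bell j + (+ 1) ^ p * bell j - (bell (suc j) + + 1 * bell j) - bell j
          ≡⟨ cong (λ u → (E ^[ p ]) bell j + u * bell j - (bell (suc j) + + 1 * bell j) - bell j) (ℤ.^-zeroˡ p) ⟩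
        (E ^[ p ]) bell j + + 1 * bell j - (bell (suc j) + + 1 * bell j) - bell j
          ≡⟨ cancel ((E ^[ p ]) bell j) (bell (suc j)) (bell j) ⟩
        touchardDefect j ∎

    touchardDefect≈0 : ∀ m → touchardDefect m ≈ + 0
    touchardDefect≈0 = <-rec (λ m → touchardDefect m ≈ + 0) step
      where
      step : ∀ m → (∀ {k} → k < m → touchardDefect k ≈ + 0) → touchardDefect m ≈ + 0
      step zero    _          = begin
        (E ^[ p ]) bell 0 - + 1 - + 1
          ≡⟨ cong (λ b → b - + 1 - + 1) (trans (E^[]-apply p bell 0) (cong bell (ℕ.+-identityʳ p))) ⟩
        bell p - + 1 - + 1
          ≈⟨ +-cong (+-cong bell-prime≈2 (≈-refl { - + 1})) (≈-refl { - + 1}) ⟩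
        + 0 ∎
      step (suc m) defect≈0 = begin
        touchardDefect (suc m)
          ≈⟨ touchardDefect-suc m ⟩
        ((E ⊕ + 1) ^[ m ]) touchardDefect 0
          ≡⟨ E⊕-^[]-at-0 (+ 1) m touchardDefect ⟩
        binomialSum m (+ 1) touchardDefect
          ≈⟨ sumℤ-≈0 (suc m) (λ k k<1+m → ≈-trans (*-congˡ (coefficient k) (defect≈0 k<1+m))
                                                  (≈-reflexive (ℤ.*-zeroʳ (coefficient k)))) ⟩
        + 0 ∎
        where
        coefficient : ℕ → ℤ
        coefficient k = + (m C k) * (+ 1) ^ (m ∸ k)

    IsTouchard : Seq → Set
    IsTouchard f = (E ^[ p ]) f ≋ (E ⊕ + 1) f

    bell-touchard : IsTouchard bell
    bell-touchard m = begin
      a                           ≡⟨ split a b c ⟩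
      (a - b - c) + (b + + 1 * c) ≈⟨ +-cong (touchardDefect≈0 m) ≈-refl ⟩
      + 0 + (b + + 1 * c)         ≡⟨ ℤ.+-identityˡ _ ⟩
      b + + 1 * c                 ∎
      where
      a = (E ^[ p ]) bell m
      b = bell (suc m)
      c = bell m
      split : ∀ a b c → a ≡ (a - b - c) + (b + + 1 * c)
      split = solve-∀

    touchard-preserved : ∀ {S} → IsLinear S → CommutesWithE S → ∀ {f} → IsTouchard f → IsTouchard (S f)
    touchard-preserved {S} S-linear S∘E≡E∘S {f} f-touchard m = begin
      (E ^[ p ]) (S f) m         ≡⟨ cong (λ g → g m) (^[]-comm {S} {E} (λ g → sym (S∘E≡E∘S g)) p f) ⟩
      S ((E ^[ p ]) f) m         ≈⟨ linear-≈-cong S-linear f-touchard m ⟩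
      S ((E ⊕ + 1) f) m          ≡⟨ ⊞-homo S-linear (E f) (+ 1 ⊡ f) m ⟩
      S (E f) m + S (+ 1 ⊡ f) m  ≡⟨ cong₂ _+_ (cong (λ g → g m) (S∘E≡E∘S f)) (⊡-homo S-linear (+ 1) f m) ⟩
      (E ⊕ + 1) (S f) m          ∎

    -- Iterating the Frobenius congruence

    ^[]-≈-cong-op : ∀ {U V} (P : Seq → Set) → IsLinear V → (∀ {f} → P f → P (U f)) → (∀ {f} → P f → U f ≋ V f) →
                    ∀ n {f} → P f → (U ^[ n ]) f ≋ (V ^[ n ]) f
    ^[]-≈-cong-op P V-linear U-preserves U≋V zero    Pf m = ≈-refl
    ^[]-≈-cong-op P V-linear U-preserves U≋V (suc n) Pf m =
      ≈-trans (^[]-≈-cong-op P V-linear U-preserves U≋V n (U-preserves Pf) m)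
              (linear-≈-cong (^[]-linear V-linear n) (U≋V Pf) m)

    frobenius-power : ∀ {T} → IsLinear T → ∀ k c f → ((T ⊕ c) ^[ p ℕ.^ k ]) f ≋ (T ^[ p ℕ.^ k ]) f ⊞ c ⊡ f
    frobenius-power T-linear zero    c f m = ≈-refl
    frobenius-power {T} T-linear (suc k) c f m = begin
      ((T ⊕ c) ^[ p ℕ.* N ]) f m
        ≡⟨ cong (λ g → g m) (^[]-* p N (T ⊕ c) f) ⟩
      (((T ⊕ c) ^[ N ]) ^[ p ]) f m
        ≈⟨ ^[]-≈-cong-op (λ _ → ⊤) (⊕-linear Tᴺ-linear c) (λ _ → tt) (λ _ → frobenius-power T-linear k c _) p tt m ⟩
      (((T ^[ N ]) ⊕ c) ^[ p ]) f m
        ≈⟨ frobenius Tᴺ-linear c f m ⟩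
      ((T ^[ N ]) ^[ p ]) f m + c ^ p * f m
        ≈⟨ +-cong (≈-reflexive (cong (λ g → g m) (sym (^[]-* p N T f)))) (*-congʳ (f m) (fermat c)) ⟩
      (T ^[ p ℕ.* N ]) f m + c * f m ∎
      where
      N = p ℕ.^ k
      Tᴺ-linear = ^[]-linear T-linear N

    touchard-power : ∀ k {f} → IsTouchard f → (E ^[ p ℕ.^ k ]) f ≋ (E ⊕ + k) f
    touchard-power zero    {f} f-touchard m = ≈-reflexive (sym (ℤ.+-identityʳ (f (suc m))))
    touchard-power (suc k) {f} f-touchard m = begin
      (E ^[ p ℕ.* N ]) f m
        ≡⟨ cong (λ g → g m) (^[]-* p N E f) ⟩
      ((E ^[ N ]) ^[ p ]) f m
        ≈⟨ ^[]-≈-cong-op IsTouchard (⊕-linear E-linear (+ k)) Eᴺ-preserves-touchard (touchard-power k) p f-touchard m ⟩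
      ((E ⊕ + k) ^[ p ]) f m
        ≈⟨ frobenius E-linear (+ k) f m ⟩
      (E ^[ p ]) f m + (+ k) ^ p * f m
        ≈⟨ +-cong (f-touchard m) (*-congʳ (f m) (fermat (+ k))) ⟩
      f (suc m) + + 1 * f m + + k * f m
        ≡⟨ collect (f (suc m)) (f m) (+ k) ⟩
      (E ⊕ + suc k) f m ∎
      where
      N = p ℕ.^ k
      Eᴺ-preserves-touchard : ∀ {g} → IsTouchard g → IsTouchard ((E ^[ N ]) g)
      Eᴺ-preserves-touchard = touchard-preserved (^[]-linear E-linear N) (E^[]-commutesWithE N)
      collect : ∀ x y k → x + + 1 * y + k * y ≡ x + (+ 1 + k) * y
      collect = solve-∀

    shift-by-prime-power : ∀ r M → ((E ⊕ - + suc r) ^[ M ℕ.+ p ℕ.^ suc r ]) bell 0 ≈ ((E ⊕ - + r) ^[ M ]) bell 0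
    shift-by-prime-power r M = begin
      ((E ⊕ c) ^[ M ℕ.+ N ]) bell 0           ≡⟨ cong (λ h → h 0) (^[]-+ M N (E ⊕ c) bell) ⟩
      ((E ⊕ c) ^[ N ]) g 0                    ≈⟨ frobenius-power E-linear (suc r) c g 0 ⟩
      (E ^[ N ]) g 0 + c * g 0                ≈⟨ +-cong (touchard-power (suc r) g-touchard 0) ≈-refl ⟩
      g 1 + + suc r * g 0 + c * g 0           ≡⟨ cancel (g 1) (g 0) (+ suc r) ⟩
      g 1                                     ≡⟨ cong (λ h → h 1) (sym (Π⊕-replicate M c bell)) ⟩
      Π⊕ (replicate M c) bell 1               ≡⟨ Π⊕-bell-shift (replicate M c) ⟩
      Π⊕ (map ℤ.suc (replicate M c)) bell 0   ≡⟨ cong (λ cs → Π⊕ cs bell 0) (map-replicate ℤ.suc M c) ⟩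
      Π⊕ (replicate M (ℤ.suc c)) bell 0       ≡⟨ cong (λ h → h 0) (Π⊕-replicate M (ℤ.suc c) bell) ⟩
      ((E ⊕ ℤ.suc c) ^[ M ]) bell 0           ≡⟨ cong (λ a → ((E ⊕ a) ^[ M ]) bell 0) (1-[1+r]≡-r (+ r)) ⟩
      ((E ⊕ - + r) ^[ M ]) bell 0             ∎
      where
      c = - + suc r
      N = p ℕ.^ suc r
      g = ((E ⊕ c) ^[ M ]) bell
      g-touchard : IsTouchard g
      g-touchard = touchard-preserved (^[]-linear (⊕-linear E-linear c) M) (E⊕^[]-commutesWithE c M) bell-touchard
      cancel : ∀ x y k → x + k * y + - k * y ≡ x
      cancel = solve-∀
      1-[1+r]≡-r : ∀ r → + 1 + - (+ 1 + r) ≡ - r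
      1-[1+r]≡-r = solve-∀

    primePowerSum : ℕ → ℕ
    primePowerSum r = sumℕ r (λ j → p ℕ.^ (j ℕ.+ 1))

    rBell≈bell : ∀ r m → rBell (m ℕ.+ primePowerSum r) (- + r) ≈ bell m
    rBell≈bell zero    m = begin
      rBell (m ℕ.+ 0) (+ 0)            ≡⟨ rBell-as-operator (m ℕ.+ 0) (+ 0) ⟩
      ((E ⊕ + 0) ^[ m ℕ.+ 0 ]) bell 0  ≡⟨ ^[]-cong-op E-linear (λ f j → ℤ.+-identityʳ (f (suc j))) (m ℕ.+ 0) bell 0 ⟩
      (E ^[ m ℕ.+ 0 ]) bell 0          ≡⟨ E^[]-apply (m ℕ.+ 0) bell 0 ⟩
      bell (m ℕ.+ 0 ℕ.+ 0)             ≡⟨ cong bell (trans (ℕ.+-identityʳ _) (ℕ.+-identityʳ m)) ⟩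
      bell m                           ∎
    rBell≈bell (suc r) m = begin
      rBell (m ℕ.+ (σ ℕ.+ p ℕ.^ (r ℕ.+ 1))) (- + suc r)
        ≡⟨ rBell-as-operator (m ℕ.+ (σ ℕ.+ p ℕ.^ (r ℕ.+ 1))) (- + suc r) ⟩
      ((E ⊕ - + suc r) ^[ m ℕ.+ (σ ℕ.+ p ℕ.^ (r ℕ.+ 1)) ]) bell 0
        ≡⟨ cong (λ n → ((E ⊕ - + suc r) ^[ n ]) bell 0) reassociate ⟩
      ((E ⊕ - + suc r) ^[ (m ℕ.+ σ) ℕ.+ p ℕ.^ suc r ]) bell 0 ≈⟨ shift-by-prime-power r (m ℕ.+ σ) ⟩
      ((E ⊕ - + r) ^[ m ℕ.+ σ ]) bell 0                      ≡⟨ sym (rBell-as-operator (m ℕ.+ σ) (- + r)) ⟩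
      rBell (m ℕ.+ σ) (- + r)                                ≈⟨ rBell≈bell r m ⟩
      bell m                                                 ∎
      where
      σ = primePowerSum r
      reassociate : m ℕ.+ (σ ℕ.+ p ℕ.^ (r ℕ.+ 1)) ≡ (m ℕ.+ σ) ℕ.+ p ℕ.^ suc r
      reassociate = trans (sym (ℕ.+-assoc m σ _)) (cong (λ e → (m ℕ.+ σ) ℕ.+ p ℕ.^ e) (ℕ.+-comm r 1))

open import Data.Nat using (ℕ; _≤_; _∸_; _^_)
import Data.Nat
open import Data.Nat.Primality using (Prime)
open import Data.Integer using (+_; -_; _-_)
open import Data.Integer.Divisibility using (_∣_)
open import Data.Nat.Properties using (m∸n+n≡m)
open import Data.Integer.Divisibility.Signed using (∣⇒∣ᵤ)
open import Relation.Binary.PropositionalEquality using (subst)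
open BellCongruences using (bell; module PrimeModulus)

corollary4 : (p r n : ℕ) → Prime p →
    sumℕ r (λ j → p ^ (j Data.Nat.+ 1)) ≤ n →
    (+ p) ∣ ((+ Bell (n ∸ sumℕ r (λ j → p ^ (j Data.Nat.+ 1)))) - rBell n (- (+ r)))
corollary4 p r n p-prime σ≤n = ∣⇒∣ᵤ (modulus-divides (≈-sym rBell≈bell-at-n))
  where
  open PrimeModulus p-prime
  m = n ∸ primePowerSum r
  rBell≈bell-at-n : rBell n (- + r) ≈ bell m
  rBell≈bell-at-n = subst (λ k → rBell k (- + r) ≈ bell m) (m∸n+n≡m σ≤n) (rBell≈bell r m)
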